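{- Let $G$ be a finite connected multigraph without loops, with vertex ordering $v_1,\ldots,v_n$ and Laplacian matrix $Q$, and suppose $\operatorname{Jac}(G)$ is cyclic with generator $\overline{E}$ for some $E\in\operatorname{Div}^0(G)$. Let $L$ be a rational $n\times n$ matrix with $QLQ=Q$. Let $D,D'\in\operatorname{Div}^0(G)$ with $\overline{D'}=x\cdot\overline{D}$ in $\operatorname{Jac}(G)$ for some integer $x$. Set $r=[D]^TL[E]\in\mathbb{Q}$ and $r'=[D']^TL[E]\in\mathbb{Q}$, and write $r=a/b$ with $a,b\in\mathbb{Z}$, $b\ge 1$, $\gcd(a,b)=1$. Then $b$ equals the order of $\overline{D}$ in $\operatorname{Jac}(G)$, the equation $r'=rx_0+y_0$ has a solution in integers $x_0,y_0$, and every such solution satisfies $x_0\equiv x \pmod{\operatorname{ord}(\overline{D})}$.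
   Context: The Laplacian matrix $Q=(q_{ij})$ has $q_{ii}=\deg(v_i)$ and, for $i\neq j$, $-q_{ij}$ equal to the number of edges joining $v_i$ and $v_j$. $\operatorname{Div}(G)$ is the free abelian group on $V(G)$; for $D\in\operatorname{Div}(G)$, $D(v)$ is the coefficient of $v$, and $[D]\in\mathbb{Z}^n$ is the column vector $(D(v_1),\ldots,D(v_n))^T$. $\operatorname{Div}^0(G)$ is the subgroup of divisors with $\sum_v D(v)=0$. For $f:V(G)\to\mathbb{Z}$, $\operatorname{div}(f)=\sum_v \big(\sum_{\{v,w\}\in E(G)}(f(v)-f(w))\big)(v)$ (edges counted with multiplicity); such divisors form the subgroup $\operatorname{Prin}(G)$. $\operatorname{Jac}(G)=\operatorname{Div}^0(G)/\operatorname{Prin}(G)$, a finite abelian group; $\overline{D}$ denotes the class of $D$ and $\operatorname{ord}(\overline{D})$ its order. -}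

module Defs where

open import Data.Nat as ℕ using (ℕ; zero; suc; NonZero)
open import Data.Integer as ℤ using (ℤ; +_)
open import Data.Rational as ℚ using (ℚ; 0ℚ)
open import Data.Fin using (Fin; zero; suc; _≟_)
open import Data.Product using (Σ; ∃; _×_)
open import Relation.Nullary using (¬_; yes; no)
open import Relation.Binary.PropositionalEquality using (_≡_; _≢_)
open import Relation.Binary.Construct.Closure.ReflexiveTransitive using (Star)

sumℤ : ∀ {n} → (Fin n → ℤ) → ℤ
sumℤ {zero} f = + 0
sumℤ {suc n} f = f zero ℤ.+ sumℤ (λ i → f (suc i))

sumℚ : ∀ {n} → (Fin n → ℚ) → ℚ
sumℚ {zero} f = 0ℚ
sumℚ {suc n} f = f zero ℚ.+ sumℚ (λ i → f (suc i))

record Multigraph (n : ℕ) : Set where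
  field
    mult      : Fin n → Fin n → ℕ
    symmetric : ∀ i j → mult i j ≡ mult j i
    loopless  : ∀ i → mult i i ≡ 0
open Multigraph public

Adjacent : ∀ {n} → Multigraph n → Fin n → Fin n → Set
Adjacent G i j = 1 ℕ.≤ mult G i j

Connected : ∀ {n} → Multigraph n → Set
Connected {n} G = (1 ℕ.≤ n) × (∀ i j → Star (Adjacent G) i j)

deg : ∀ {n} → Multigraph n → Fin n → ℤ
deg G i = sumℤ (λ w → + mult G i w)

laplacian : ∀ {n} → Multigraph n → Fin n → Fin n → ℤ
laplacian G i j with i ≟ j
... | yes _ = deg G i
... | no  _ = ℤ.- (+ mult G i j)

Matℚ : ℕ → Set
Matℚ n = Fin n → Fin n → ℚ

_⊗_ : ∀ {n} → Matℚ n → Matℚ n → Matℚ n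
(M ⊗ N) i j = sumℚ (λ k → M i k ℚ.* N k j)

toℚ : ℤ → ℚ
toℚ z = z ℚ./ 1

laplacianℚ : ∀ {n} → Multigraph n → Matℚ n
laplacianℚ G i j = toℚ (laplacian G i j)

Div : ℕ → Set
Div n = Fin n → ℤ

_-ᴰ_ : ∀ {n} → Div n → Div n → Div n
(D -ᴰ D') v = D v ℤ.- D' v

_·ᴰ_ : ∀ {n} → ℤ → Div n → Div n
(m ·ᴰ D) v = m ℤ.* D v

deg-div : ∀ {n} → Div n → ℤ
deg-div D = sumℤ D

InDiv0 : ∀ {n} → Div n → Set
InDiv0 D = deg-div D ≡ + 0

divf : ∀ {n} → Multigraph n → (Fin n → ℤ) → Div n
divf G f v = sumℤ (λ w → + mult G v w ℤ.* (f v ℤ.- f w))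

InPrin : ∀ {n} → Multigraph n → Div n → Set
InPrin {n} G D = Σ (Fin n → ℤ) λ f → ∀ v → D v ≡ divf G f v

SameClass : ∀ {n} → Multigraph n → Div n → Div n → Set
SameClass G D D' = InPrin G (D -ᴰ D')

CyclicGenerator : ∀ {n} → Multigraph n → Div n → Set
CyclicGenerator G E =
  InDiv0 E × (∀ D → InDiv0 D → ∃ λ (m : ℤ) → SameClass G D (m ·ᴰ E))

IsOrder : ∀ {n} → Multigraph n → Div n → ℕ → Set
IsOrder G D m =
  (1 ℕ.≤ m) × InPrin G ((+ m) ·ᴰ D) ×
  (∀ k → 1 ℕ.≤ k → k ℕ.< m → ¬ InPrin G ((+ k) ·ᴰ D))

bilin : ∀ {n} → Div n → Matℚ n → Div n → ℚ
bilin D L E = sumℚ (λ i → sumℚ (λ j → toℚ (D i) ℚ.* L i j ℚ.* toℚ (E j)))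

module Submission where

-- Plan of the file.
--  * Integers inside ℚ, finite sums (the library ∑ over ℚ), vectors and matrices.
--  * Laplacian: Q is symmetric, (Qh)ᵢ = Σⱼ μᵢⱼ (hᵢ - hⱼ), [div f] = Q[f], and the maximum
--    principle: on a connected graph every harmonic vector (Qh = 0) is constant.
--  * Generalized inverse: each row of I - QL is harmonic, hence constant, so QLY = Y
--    whenever Σ Y = 0.  Consequently, on Div⁰ the pairing is symmetric, ⟨div f, Y⟩ = Σ f·Y
--    is an integer, and conversely X ∈ Div⁰ is principal once ⟨F,X⟩ ∈ ℤ for all F ∈ Div⁰;
--    with Jac(G) = ⟨Ē⟩ it suffices that ⟨E,X⟩ ∈ ℤ.
--  * Order: k·D principal ⟹ k·(a/b) ∈ ℤ ⟹ b ∣ k, while ⟨E, b·D⟩ = b·(a/b) = a makes b·D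
--    principal; hence b = ord(D̄).
--  * Logarithm: D' = x·D + div g gives r' = r·x + Σ g·E, and any other solution of
--    r' = r·x₀ + y₀ has (x₀ - x)·r ∈ ℤ, so b ∣ x₀ - x.

open import Defs
open import Data.Nat using (ℕ; NonZero)
open import Data.Integer using (ℤ; ∣_∣; +_; _-_)
open import Data.Integer.Divisibility using (_∣_)
open import Data.Nat.Coprimality using (Coprime)
open import Data.Rational using (ℚ; _/_; _+_; _*_)
open import Data.Product using (∃₂; _×_)
open import Relation.Binary.PropositionalEquality using (_≡_)

open import Algebra.Bundles using (Ring)
open import Data.Empty using (⊥-elim)
open import Data.Fin using (Fin; zero; suc; _≟_; fromℕ<)
open import Data.Nat using (zero; suc)
open import Data.Product using (Σ; ∃; _,_; proj₁; proj₂)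
open import Data.Rational using (0ℚ; 1ℚ; _≤_)
open import Data.Sum using (inj₁; inj₂)
open import Relation.Binary.Construct.Closure.ReflexiveTransitive using (Star; ε; _◅_)
open import Relation.Binary.Definitions using (tri<; tri≈; tri>)
open import Relation.Binary.PropositionalEquality
  using (refl; sym; trans; cong; cong₂; subst; _≢_; module ≡-Reasoning)
open import Relation.Nullary using (¬_; yes; no)
import Data.Integer as ℤ
import Data.Integer.Properties as ℤP
import Data.Nat as ℕ
import Data.Nat.Coprimality as ℕC
import Data.Nat.Divisibility as ℕD
import Data.Nat.Properties as ℕP
import Data.Rational as ℚ
import Data.Rational.Properties as ℚP
import Data.Rational.Unnormalised as ℚᵘ
import Data.Rational.Unnormalised.Properties as ℚᵘP
open import Algebra.Properties.Group ℚP.+-0-group using () renaming (x∙y⁻¹≈ε⇒x≈y to x-y≡0⇒x≡y)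
open import Algebra.Properties.Semiring.Sum (Ring.semiring ℚP.+-*-ring)
  using (sum-syntax; sum-cong-≗; ∑-distrib-+; ∑-comm; *-distribˡ-sum; *-distribʳ-sum; sum-replicate-zero)
open import Data.Integer.Solver using () renaming (module +-*-Solver to ℤ-Solver)
open import Data.Rational.Solver using () renaming (module +-*-Solver to ℚ-Solver)

toℚᵘ-toℚ : ∀ z → ℚ.toℚᵘ (toℚ z) ℚᵘ.≃ ℚᵘ.mkℚᵘ z 0
toℚᵘ-toℚ z = ℚP.toℚᵘ-fromℚᵘ (ℚᵘ.mkℚᵘ z 0)

toℚ-+ : ∀ x y → toℚ (x ℤ.+ y) ≡ toℚ x + toℚ y
toℚ-+ x y = ℚP.toℚᵘ-injective (begin
  ℚ.toℚᵘ (toℚ (x ℤ.+ y))              ≈⟨ toℚᵘ-toℚ (x ℤ.+ y) ⟩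
  ℚᵘ.mkℚᵘ (x ℤ.+ y) 0                 ≈⟨ ℚᵘ.*≡* (solve 2 (λ x y →
                                            (x :+ y) :* con (+ 1) := (x :* con (+ 1) :+ y :* con (+ 1)) :* con (+ 1))
                                            refl x y) ⟩
  ℚᵘ.mkℚᵘ x 0 ℚᵘ.+ ℚᵘ.mkℚᵘ y 0        ≈⟨ ℚᵘP.+-cong (toℚᵘ-toℚ x) (toℚᵘ-toℚ y) ⟨
  ℚ.toℚᵘ (toℚ x) ℚᵘ.+ ℚ.toℚᵘ (toℚ y)  ≈⟨ ℚP.toℚᵘ-homo-+ (toℚ x) (toℚ y) ⟨
  ℚ.toℚᵘ (toℚ x + toℚ y)              ∎)
  where open ℚᵘP.≃-Reasoning
        open ℤ-Solver

toℚ-* : ∀ x y → toℚ (x ℤ.* y) ≡ toℚ x * toℚ y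
toℚ-* x y = ℚP.toℚᵘ-injective (begin
  ℚ.toℚᵘ (toℚ (x ℤ.* y))              ≈⟨ toℚᵘ-toℚ (x ℤ.* y) ⟩
  ℚᵘ.mkℚᵘ x 0 ℚᵘ.* ℚᵘ.mkℚᵘ y 0        ≈⟨ ℚᵘP.*-cong (toℚᵘ-toℚ x) (toℚᵘ-toℚ y) ⟨
  ℚ.toℚᵘ (toℚ x) ℚᵘ.* ℚ.toℚᵘ (toℚ y)  ≈⟨ ℚP.toℚᵘ-homo-* (toℚ x) (toℚ y) ⟨
  ℚ.toℚᵘ (toℚ x * toℚ y)              ∎)
  where open ℚᵘP.≃-Reasoning

toℚ-neg : ∀ x → toℚ (ℤ.- x) ≡ ℚ.- toℚ x
toℚ-neg x = ℚP.toℚᵘ-injective (begin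
  ℚ.toℚᵘ (toℚ (ℤ.- x))   ≈⟨ toℚᵘ-toℚ (ℤ.- x) ⟩
  ℚᵘ.- ℚᵘ.mkℚᵘ x 0       ≈⟨ ℚᵘP.-‿cong (toℚᵘ-toℚ x) ⟨
  ℚᵘ.- ℚ.toℚᵘ (toℚ x)    ≈⟨ ℚP.toℚᵘ-homo‿- (toℚ x) ⟨
  ℚ.toℚᵘ (ℚ.- toℚ x)     ∎)
  where open ℚᵘP.≃-Reasoning

toℚ-- : ∀ x y → toℚ (x - y) ≡ toℚ x ℚ.- toℚ y
toℚ-- x y = trans (toℚ-+ x (ℤ.- y)) (cong (λ q → toℚ x + q) (toℚ-neg y))

toℚ-injective : ∀ {x y} → toℚ x ≡ toℚ y → x ≡ y
toℚ-injective {x} {y} eq with ℚᵘP.≃-trans (ℚᵘP.≃-sym (toℚᵘ-toℚ x))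
                                (ℚᵘP.≃-trans (ℚᵘP.≃-reflexive (cong ℚ.toℚᵘ eq)) (toℚᵘ-toℚ y))
... | ℚᵘ.*≡* x*1≡y*1 = trans (sym (ℤP.*-identityʳ x)) (trans x*1≡y*1 (ℤP.*-identityʳ y))

toℚ-nonneg : ∀ m → 0ℚ ≤ toℚ (+ m)
toℚ-nonneg m = ℚP.nonNegative⁻¹ (toℚ (+ m)) {{ℚP.normalize-nonNeg m 1}}

*-/-cancel : ∀ a b .{{_ : NonZero b}} → toℚ (+ b) * (a / b) ≡ toℚ a
*-/-cancel a (suc b) = ℚP.toℚᵘ-injective (begin
  ℚ.toℚᵘ (toℚ (+ suc b) * (a / suc b))                        ≈⟨ ℚP.toℚᵘ-homo-* (toℚ (+ suc b)) (a / suc b) ⟩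
  ℚ.toℚᵘ (toℚ (+ suc b)) ℚᵘ.* ℚ.toℚᵘ (ℚ.fromℚᵘ (ℚᵘ.mkℚᵘ a b)) ≈⟨ ℚᵘP.*-cong (toℚᵘ-toℚ (+ suc b)) (ℚP.toℚᵘ-fromℚᵘ (ℚᵘ.mkℚᵘ a b)) ⟩
  ℚᵘ.mkℚᵘ (+ suc b) 0 ℚᵘ.* ℚᵘ.mkℚᵘ a b                         ≈⟨ ℚᵘ.*≡* (solve 2 (λ a b →
                                                                   b :* a :* con (+ 1) := a :* (con (+ 1) :* b)) refl a (+ suc b)) ⟩
  ℚᵘ.mkℚᵘ a 0                                                  ≈⟨ toℚᵘ-toℚ a ⟨
  ℚ.toℚᵘ (toℚ a)                                               ∎)
  where open ℚᵘP.≃-Reasoning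
        open ℤ-Solver

sumℚ≡∑ : ∀ {n} (f : Fin n → ℚ) → sumℚ f ≡ ∑[ i < n ] f i
sumℚ≡∑ {zero} f = refl
sumℚ≡∑ {suc n} f = cong (λ s → f zero + s) (sumℚ≡∑ (λ i → f (suc i)))

toℚ-sumℤ : ∀ {n} (f : Fin n → ℤ) → toℚ (sumℤ f) ≡ ∑[ i < n ] toℚ (f i)
toℚ-sumℤ {zero} f = refl
toℚ-sumℤ {suc n} f = trans (toℚ-+ (f zero) _) (cong (λ s → toℚ (f zero) + s) (toℚ-sumℤ (λ i → f (suc i))))

∑-distrib-- : ∀ {n} (f g : Fin n → ℚ) →
              ∑[ i < n ] (f i ℚ.- g i) ≡ (∑[ i < n ] f i) ℚ.- (∑[ i < n ] g i)
∑-distrib-- {zero} f g = refl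
∑-distrib-- {suc n} f g =
  trans (cong (λ s → (f zero ℚ.- g zero) + s) (∑-distrib-- (λ i → f (suc i)) (λ i → g (suc i))))
        (solve 4 (λ a b c d → (a :- b) :+ (c :- d) := (a :+ c) :- (b :+ d)) refl
               (f zero) (g zero) (∑[ i < n ] f (suc i)) (∑[ i < n ] g (suc i)))
  where open ℚ-Solver

-- The Kronecker delta; δ i is the divisor (vᵢ).
δ : ∀ {n} → Fin n → Fin n → ℤ
δ zero    zero    = + 1
δ zero    (suc _) = + 0
δ (suc _) zero    = + 0
δ (suc i) (suc j) = δ i j

δ-diag : ∀ {n} (i : Fin n) → δ i i ≡ + 1
δ-diag zero    = refl
δ-diag (suc i) = δ-diag i

δ-off : ∀ {n} {i j : Fin n} → i ≢ j → δ i j ≡ + 0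
δ-off {i = zero}  {zero}  i≢j = ⊥-elim (i≢j refl)
δ-off {i = zero}  {suc j} i≢j = refl
δ-off {i = suc i} {zero}  i≢j = refl
δ-off {i = suc i} {suc j} i≢j = δ-off (λ i≡j → i≢j (cong suc i≡j))

∑-δ : ∀ {n} (i : Fin n) (g : Fin n → ℚ) → ∑[ j < n ] (toℚ (δ i j) * g j) ≡ g i
∑-δ {suc n} zero g =
  trans (cong₂ _+_ (ℚP.*-identityˡ (g zero))
                   (trans (sum-cong-≗ (λ j → ℚP.*-zeroˡ (g (suc j)))) (sum-replicate-zero n)))
        (ℚP.+-identityʳ (g zero))
∑-δ (suc i) g = trans (cong₂ _+_ (ℚP.*-zeroˡ (g zero)) (∑-δ i (λ j → g (suc j))))
                      (ℚP.+-identityˡ (g (suc i)))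

∑-nonneg : ∀ {n} (f : Fin n → ℚ) → (∀ i → 0ℚ ≤ f i) → 0ℚ ≤ ∑[ i < n ] f i
∑-nonneg {zero}  f f≥0 = ℚP.≤-refl
∑-nonneg {suc n} f f≥0 = ℚP.+-mono-≤ (f≥0 zero) (∑-nonneg (λ i → f (suc i)) (λ i → f≥0 (suc i)))

+-nonneg-zeroˡ : ∀ {x y} → 0ℚ ≤ x → 0ℚ ≤ y → x + y ≡ 0ℚ → x ≡ 0ℚ
+-nonneg-zeroˡ {x} {y} x≥0 y≥0 x+y≡0 = ℚP.≤-antisym x≤0 x≥0
  where
  x≤0 : x ≤ 0ℚ
  x≤0 = subst (x ≤_) x+y≡0 (subst (_≤ x + y) (ℚP.+-identityʳ x) (ℚP.+-monoʳ-≤ x y≥0))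

∑-nonneg-zero : ∀ {n} (f : Fin n → ℚ) → (∀ i → 0ℚ ≤ f i) → ∑[ i < n ] f i ≡ 0ℚ → ∀ i → f i ≡ 0ℚ
∑-nonneg-zero {suc n} f f≥0 ∑≡0 zero = +-nonneg-zeroˡ (f≥0 zero) (∑-nonneg _ (λ i → f≥0 (suc i))) ∑≡0
∑-nonneg-zero {suc n} f f≥0 ∑≡0 (suc i) =
  ∑-nonneg-zero (λ i → f (suc i)) (λ i → f≥0 (suc i))
    (+-nonneg-zeroˡ (∑-nonneg _ (λ i → f≥0 (suc i))) (f≥0 zero) (trans (ℚP.+-comm _ (f zero)) ∑≡0)) i

Vecℚ : ℕ → Set
Vecℚ n = Fin n → ℚ

infixr 7 _*ᵥ_
infix  7 _·_

_*ᵥ_ : ∀ {n} → Matℚ n → Vecℚ n → Vecℚ n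
(M *ᵥ v) i = ∑[ j < _ ] (M i j * v j)

_·_ : ∀ {n} → Vecℚ n → Vecℚ n → ℚ
u · v = ∑[ i < _ ] (u i * v i)

[_] : ∀ {n} → (Fin n → ℤ) → Vecℚ n
[ X ] i = toℚ (X i)

Symmetric : ∀ {n} → Matℚ n → Set
Symmetric M = ∀ i j → M i j ≡ M j i

·-congˡ : ∀ {n} {u u′ : Vecℚ n} v → (∀ i → u i ≡ u′ i) → u · v ≡ u′ · v
·-congˡ v u≗u′ = sum-cong-≗ (λ i → cong (_* v i) (u≗u′ i))

·-congʳ : ∀ {n} u {v v′ : Vecℚ n} → (∀ i → v i ≡ v′ i) → u · v ≡ u · v′
·-congʳ u v≗v′ = sum-cong-≗ (λ i → cong (u i *_) (v≗v′ i))

·-comm : ∀ {n} (u v : Vecℚ n) → u · v ≡ v · u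
·-comm u v = sum-cong-≗ (λ i → ℚP.*-comm (u i) (v i))

*ᵥ-self-adjoint : ∀ {n} {M : Matℚ n} → Symmetric M → ∀ u v → (M *ᵥ u) · v ≡ u · (M *ᵥ v)
*ᵥ-self-adjoint {n} {M} M-sym u v = begin
  ∑[ i < n ] ((M *ᵥ u) i * v i)                 ≡⟨ sum-cong-≗ (λ i → *-distribʳ-sum (v i) (λ j → M i j * u j)) ⟩
  ∑[ i < n ] ∑[ j < n ] (M i j * u j * v i)     ≡⟨ ∑-comm (λ i j → M i j * u j * v i) ⟩
  ∑[ j < n ] ∑[ i < n ] (M i j * u j * v i)     ≡⟨ sum-cong-≗ (λ j → sum-cong-≗ (λ i → transpose i j)) ⟩
  ∑[ j < n ] ∑[ i < n ] (u j * (M j i * v i))   ≡⟨ sum-cong-≗ (λ j → *-distribˡ-sum (u j) (λ i → M j i * v i)) ⟨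
  ∑[ j < n ] (u j * (M *ᵥ v) j)                 ∎
  where
  open ≡-Reasoning
  open ℚ-Solver
  transpose : ∀ i j → M i j * u j * v i ≡ u j * (M j i * v i)
  transpose i j = trans (cong (λ m → m * u j * v i) (M-sym i j))
                        (solve 3 (λ m a b → m :* a :* b := a :* (m :* b)) refl (M j i) (u j) (v i))

*ᵥ-⊗ : ∀ {n} (M N : Matℚ n) v i → (M *ᵥ (N *ᵥ v)) i ≡ ((M ⊗ N) *ᵥ v) i
*ᵥ-⊗ {n} M N v i = begin
  ∑[ j < n ] (M i j * ∑[ k < n ] (N j k * v k))   ≡⟨ sum-cong-≗ (λ j → *-distribˡ-sum (M i j) (λ k → N j k * v k)) ⟩
  ∑[ j < n ] ∑[ k < n ] (M i j * (N j k * v k))   ≡⟨ ∑-comm (λ j k → M i j * (N j k * v k)) ⟩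
  ∑[ k < n ] ∑[ j < n ] (M i j * (N j k * v k))   ≡⟨ sum-cong-≗ (λ k → sum-cong-≗ (λ j → ℚP.*-assoc (M i j) (N j k) (v k))) ⟨
  ∑[ k < n ] ∑[ j < n ] (M i j * N j k * v k)     ≡⟨ sum-cong-≗ (λ k → *-distribʳ-sum (v k) (λ j → M i j * N j k)) ⟨
  ∑[ k < n ] ((∑[ j < n ] (M i j * N j k)) * v k) ≡⟨ sum-cong-≗ (λ k → cong (_* v k) (sumℚ≡∑ (λ j → M i j * N j k))) ⟨
  ((M ⊗ N) *ᵥ v) i                                ∎
  where open ≡-Reasoning

bilin-· : ∀ {n} (X : Div n) L (Y : Div n) → bilin X L Y ≡ [ X ] · (L *ᵥ [ Y ])
bilin-· {n} X L Y = begin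
  sumℚ (λ i → sumℚ (λ j → [ X ] i * L i j * [ Y ] j))   ≡⟨ sumℚ≡∑ (λ i → sumℚ (λ j → [ X ] i * L i j * [ Y ] j)) ⟩
  ∑[ i < n ] sumℚ (λ j → [ X ] i * L i j * [ Y ] j)     ≡⟨ sum-cong-≗ (λ i → sumℚ≡∑ (λ j → [ X ] i * L i j * [ Y ] j)) ⟩
  ∑[ i < n ] ∑[ j < n ] ([ X ] i * L i j * [ Y ] j)     ≡⟨ sum-cong-≗ (λ i → sum-cong-≗ (λ j → ℚP.*-assoc ([ X ] i) (L i j) ([ Y ] j))) ⟩
  ∑[ i < n ] ∑[ j < n ] ([ X ] i * (L i j * [ Y ] j))   ≡⟨ sum-cong-≗ (λ i → *-distribˡ-sum ([ X ] i) (λ j → L i j * [ Y ] j)) ⟨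
  [ X ] · (L *ᵥ [ Y ])                                  ∎
  where open ≡-Reasoning

argmax : ∀ {n} (h : Vecℚ n) → Fin n → Σ (Fin n) λ i → ∀ j → h j ≤ h i
argmax {suc zero} h _ = zero , λ { zero → ℚP.≤-refl }
argmax {suc (suc n)} h _ with argmax (λ j → h (suc j)) zero
... | i , max with ℚP.≤-total (h zero) (h (suc i))
...   | inj₁ h₀≤ = suc i , λ { zero → h₀≤ ; (suc j) → max j }
...   | inj₂ ≤h₀ = zero  , λ { zero → ℚP.≤-refl ; (suc j) → ℚP.≤-trans (max j) ≤h₀ }

*-nonneg : ∀ {x y} → 0ℚ ≤ x → 0ℚ ≤ y → 0ℚ ≤ x * y
*-nonneg {x} {y} x≥0 y≥0 =
  ℚP.nonNegative⁻¹ _ {{ℚP.nonNeg*nonNeg⇒nonNeg x {{ℚ.nonNegative x≥0}} y {{ℚ.nonNegative y≥0}}}}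

≤⇒-nonneg : ∀ {p q} → q ≤ p → 0ℚ ≤ p ℚ.- q
≤⇒-nonneg {p} {q} q≤p = subst (_≤ p ℚ.- q) (ℚP.+-inverseʳ q) (ℚP.+-monoˡ-≤ (ℚ.- q) q≤p)

*-pos-zero : ∀ m {d} → 1 ℕ.≤ m → 0ℚ ≤ d → toℚ (+ m) * d ≡ 0ℚ → d ≡ 0ℚ
*-pos-zero (suc m) {d} _ d≥0 md≡0 = +-nonneg-zeroˡ d≥0 (*-nonneg (toℚ-nonneg m) d≥0) (begin
  d + toℚ (+ m) * d            ≡⟨ cong (_+ toℚ (+ m) * d) (ℚP.*-identityˡ d) ⟨
  1ℚ * d + toℚ (+ m) * d       ≡⟨ ℚP.*-distribʳ-+ d 1ℚ (toℚ (+ m)) ⟨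
  (1ℚ + toℚ (+ m)) * d         ≡⟨ cong (_* d) (toℚ-+ (+ 1) (+ m)) ⟨
  toℚ (+ suc m) * d            ≡⟨ md≡0 ⟩
  0ℚ                           ∎)
  where open ≡-Reasoning

-- § The Laplacian of a multigraph

module Laplacian {n} (G : Multigraph n) where

  Q : Matℚ n
  Q = laplacianℚ G

  μ : Fin n → Fin n → ℚ
  μ i j = toℚ (+ mult G i j)

  Q-symmetric : Symmetric Q
  Q-symmetric i j = cong toℚ (laplacian-sym i j)
    where
    laplacian-sym : ∀ i j → laplacian G i j ≡ laplacian G j i
    laplacian-sym i j with i ≟ j | j ≟ i
    ... | yes refl | yes _    = refl
    ... | yes refl | no  i≢i  = ⊥-elim (i≢i refl)
    ... | no  i≢i  | yes refl = ⊥-elim (i≢i refl)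
    ... | no  _    | no  _    = cong (λ m → ℤ.- (+ m)) (symmetric G i j)

  Q-δ : ∀ i j → Q i j ≡ toℚ (δ i j) * toℚ (deg G i) ℚ.- μ i j
  Q-δ i j with i ≟ j
  ... | yes refl rewrite δ-diag i | loopless G i =
        solve 1 (λ d → d := con 1ℚ :* d :- con 0ℚ) refl (toℚ (deg G i))
        where open ℚ-Solver
  ... | no i≢j rewrite δ-off i≢j =
        trans (toℚ-neg (+ mult G i j)) (solve 2 (λ d m → :- m := con 0ℚ :* d :- m) refl (toℚ (deg G i)) (μ i j))
        where open ℚ-Solver

  Q-action : ∀ (h : Vecℚ n) i → (Q *ᵥ h) i ≡ ∑[ j < n ] (μ i j * (h i ℚ.- h j))
  Q-action h i = begin
    ∑[ j < n ] (Q i j * h j)                                           ≡⟨ sum-cong-≗ split ⟩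
    ∑[ j < n ] (toℚ (δ i j) * (d * h j) ℚ.- μ i j * h j)               ≡⟨ ∑-distrib-- _ (λ j → μ i j * h j) ⟩
    ∑[ j < n ] (toℚ (δ i j) * (d * h j)) ℚ.- ∑[ j < n ] (μ i j * h j) ≡⟨ cong (ℚ._- μh) (∑-δ i (λ j → d * h j)) ⟩
    d * h i ℚ.- ∑[ j < n ] (μ i j * h j)                               ≡⟨ cong (λ e → e * h i ℚ.- μh) (toℚ-sumℤ (λ j → + mult G i j)) ⟩
    (∑[ j < n ] μ i j) * h i ℚ.- ∑[ j < n ] (μ i j * h j)              ≡⟨ cong (ℚ._- μh) (*-distribʳ-sum (h i) (μ i)) ⟩
    ∑[ j < n ] (μ i j * h i) ℚ.- ∑[ j < n ] (μ i j * h j)              ≡⟨ ∑-distrib-- (λ j → μ i j * h i) (λ j → μ i j * h j) ⟨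
    ∑[ j < n ] (μ i j * h i ℚ.- μ i j * h j)                           ≡⟨ sum-cong-≗ factor ⟩
    ∑[ j < n ] (μ i j * (h i ℚ.- h j))                                 ∎
    where
    open ≡-Reasoning
    open ℚ-Solver
    d = toℚ (deg G i)
    μh = ∑[ j < n ] (μ i j * h j)
    split : ∀ j → Q i j * h j ≡ toℚ (δ i j) * (d * h j) ℚ.- μ i j * h j
    split j = trans (cong (_* h j) (Q-δ i j))
      (solve 4 (λ δᵢⱼ d m x → (δᵢⱼ :* d :- m) :* x := δᵢⱼ :* (d :* x) :- m :* x) refl (toℚ (δ i j)) d (μ i j) (h j))
    factor : ∀ j → μ i j * h i ℚ.- μ i j * h j ≡ μ i j * (h i ℚ.- h j)
    factor j = solve 3 (λ m a b → m :* a :- m :* b := m :* (a :- b)) refl (μ i j) (h i) (h j)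

  divf-Q : ∀ f v → [ divf G f ] v ≡ (Q *ᵥ [ f ]) v
  divf-Q f v = begin
    toℚ (divf G f v)                                 ≡⟨ toℚ-sumℤ (λ w → + mult G v w ℤ.* (f v - f w)) ⟩
    ∑[ w < n ] toℚ (+ mult G v w ℤ.* (f v - f w))   ≡⟨ sum-cong-≗ term ⟩
    ∑[ w < n ] (μ v w * ([ f ] v ℚ.- [ f ] w))     ≡⟨ Q-action [ f ] v ⟨
    (Q *ᵥ [ f ]) v                                   ∎
    where
    open ≡-Reasoning
    term : ∀ w → toℚ (+ mult G v w ℤ.* (f v - f w)) ≡ μ v w * ([ f ] v ℚ.- [ f ] w)
    term w = trans (toℚ-* (+ mult G v w) (f v - f w)) (cong (μ v w *_) (toℚ-- (f v) (f w)))

  -- At a maximum i of a harmonic h every neighbour k has h k = h i: (Qh)ᵢ = Σₗ μᵢₗ (hᵢ - hₗ)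
  -- is a sum of nonnegative terms, so the term of k vanishes, and μᵢₖ ≥ 1.
  harmonic-max-neighbour : ∀ (h : Vecℚ n) i → (Q *ᵥ h) i ≡ 0ℚ → (∀ j → h j ≤ h i) →
                           ∀ k → Adjacent G i k → h k ≡ h i
  harmonic-max-neighbour h i Qh≡0 max k i~k = sym (x-y≡0⇒x≡y (h i) (h k) gap≡0)
    where
    gap-nonneg : ∀ l → 0ℚ ≤ μ i l * (h i ℚ.- h l)
    gap-nonneg l = *-nonneg (toℚ-nonneg (mult G i l)) (≤⇒-nonneg (max l))
    gap≡0 : h i ℚ.- h k ≡ 0ℚ
    gap≡0 = *-pos-zero (mult G i k) i~k (≤⇒-nonneg (max k))
              (∑-nonneg-zero _ gap-nonneg (trans (sym (Q-action h i)) Qh≡0) k)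

  harmonic⇒constant : (∀ i j → Star (Adjacent G) i j) →
                      ∀ (h : Vecℚ n) → (∀ i → (Q *ᵥ h) i ≡ 0ℚ) → ∀ i j → h i ≡ h j
  harmonic⇒constant walks h harmonic i j with argmax h i
  ... | top , max = trans (along-walk max (walks top i)) (sym (along-walk max (walks top j)))
    where
    along-walk : ∀ {t k} → (∀ l → h l ≤ h t) → Star (Adjacent G) t k → h k ≡ h t
    along-walk max ε = refl
    along-walk {t} max (t~s ◅ walk) = trans (along-walk max′ walk) hs≡ht
      where
      hs≡ht = harmonic-max-neighbour h t (harmonic t) max _ t~s
      max′ = λ l → subst (h l ≤_) (sym hs≡ht) (max l)

-- § Degree-zero divisors

Div⁰⇒∑≡0 : ∀ {n} (Y : Div n) → InDiv0 Y → ∑[ i < n ] [ Y ] i ≡ 0ℚ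
Div⁰⇒∑≡0 Y deg≡0 = trans (sym (toℚ-sumℤ Y)) (cong toℚ deg≡0)

∑≡0⇒Div⁰ : ∀ {n} (Y : Div n) → ∑[ i < n ] [ Y ] i ≡ 0ℚ → InDiv0 Y
∑≡0⇒Div⁰ Y ∑≡0 = toℚ-injective (trans (toℚ-sumℤ Y) ∑≡0)

Div⁰-scale : ∀ {n} k (D : Div n) → InDiv0 D → InDiv0 (k ·ᴰ D)
Div⁰-scale {n} k D D∈Div⁰ = ∑≡0⇒Div⁰ (k ·ᴰ D) (begin
  ∑[ i < n ] toℚ (k ℤ.* D i)    ≡⟨ sum-cong-≗ (λ i → toℚ-* k (D i)) ⟩
  ∑[ i < n ] (toℚ k * [ D ] i)  ≡⟨ *-distribˡ-sum (toℚ k) [ D ] ⟨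
  toℚ k * ∑[ i < n ] [ D ] i    ≡⟨ cong (toℚ k *_) (Div⁰⇒∑≡0 D D∈Div⁰) ⟩
  toℚ k * 0ℚ                    ≡⟨ ℚP.*-zeroʳ (toℚ k) ⟩
  0ℚ                            ∎)
  where open ≡-Reasoning

v-diff : ∀ {n} → Fin n → Fin n → Div n
v-diff i j v = δ i v - δ j v

∑-v-diff : ∀ {n} (i j : Fin n) (g : Vecℚ n) → ∑[ v < n ] ([ v-diff i j ] v * g v) ≡ g i ℚ.- g j
∑-v-diff {n} i j g = begin
  ∑[ v < n ] ([ v-diff i j ] v * g v)                                  ≡⟨ sum-cong-≗ split ⟩
  ∑[ v < n ] (toℚ (δ i v) * g v ℚ.- toℚ (δ j v) * g v)                 ≡⟨ ∑-distrib-- _ (λ v → toℚ (δ j v) * g v) ⟩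
  ∑[ v < n ] (toℚ (δ i v) * g v) ℚ.- ∑[ v < n ] (toℚ (δ j v) * g v)    ≡⟨ cong₂ ℚ._-_ (∑-δ i g) (∑-δ j g) ⟩
  g i ℚ.- g j                                                          ∎
  where
  open ≡-Reasoning
  open ℚ-Solver
  split : ∀ v → [ v-diff i j ] v * g v ≡ toℚ (δ i v) * g v ℚ.- toℚ (δ j v) * g v
  split v = trans (cong (_* g v) (toℚ-- (δ i v) (δ j v)))
                  (solve 3 (λ a b c → (a :- b) :* c := a :* c :- b :* c) refl (toℚ (δ i v)) (toℚ (δ j v)) (g v))

Div⁰-v-diff : ∀ {n} (i j : Fin n) → InDiv0 (v-diff i j)
Div⁰-v-diff i j = ∑≡0⇒Div⁰ (v-diff i j)
  (trans (sum-cong-≗ (λ v → sym (ℚP.*-identityʳ ([ v-diff i j ] v))))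
         (trans (∑-v-diff i j (λ _ → 1ℚ)) (ℚP.+-inverseʳ 1ℚ)))

denominator-divides : ∀ a b .{{_ : NonZero b}} → Coprime ∣ a ∣ b →
                      ∀ k z → toℚ k * (a / b) ≡ toℚ z → b ℕD.∣ ∣ k ∣
denominator-divides a b a⊥b k z k[a/b]≡z =
  ℕC.coprime-divisor (ℕC.sym a⊥b) (ℕD.divides ∣ z ∣ ∣a∣∣k∣≡∣z∣b)
  where
  a*k≡z*b : a ℤ.* k ≡ z ℤ.* + b
  a*k≡z*b = toℚ-injective (begin
    toℚ (a ℤ.* k)                     ≡⟨ toℚ-* a k ⟩
    toℚ a * toℚ k                     ≡⟨ cong (_* toℚ k) (*-/-cancel a b) ⟨
    toℚ (+ b) * (a / b) * toℚ k       ≡⟨ solve 3 (λ x y w → x :* y :* w := w :* y :* x) refl (toℚ (+ b)) (a / b) (toℚ k) ⟩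
    toℚ k * (a / b) * toℚ (+ b)       ≡⟨ cong (_* toℚ (+ b)) k[a/b]≡z ⟩
    toℚ z * toℚ (+ b)                 ≡⟨ toℚ-* z (+ b) ⟨
    toℚ (z ℤ.* + b)                   ∎)
    where open ≡-Reasoning
          open ℚ-Solver
  ∣a∣∣k∣≡∣z∣b : ∣ a ∣ ℕ.* ∣ k ∣ ≡ ∣ z ∣ ℕ.* b
  ∣a∣∣k∣≡∣z∣b = trans (sym (ℤP.abs-* a k)) (trans (cong ∣_∣ a*k≡z*b) (ℤP.abs-* z (+ b)))

solutions-differ : ∀ r x₀ y₀ x y → r * toℚ x₀ + toℚ y₀ ≡ r * toℚ x + toℚ y →
                   toℚ (x₀ - x) * r ≡ toℚ (y - y₀)
solutions-differ r x₀ y₀ x y same = begin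
  toℚ (x₀ - x) * r                                               ≡⟨ cong (_* r) (toℚ-- x₀ x) ⟩
  (toℚ x₀ ℚ.- toℚ x) * r                                         ≡⟨ solve 5 (λ x₀ x r y₀ y →
      (x₀ :- x) :* r := ((r :* x₀ :+ y₀) :- (r :* x :+ y)) :+ (y :- y₀)) refl (toℚ x₀) (toℚ x) r (toℚ y₀) (toℚ y) ⟩
  ((r * toℚ x₀ + toℚ y₀) ℚ.- (r * toℚ x + toℚ y)) + (toℚ y ℚ.- toℚ y₀) ≡⟨ cong (λ s → s + (toℚ y ℚ.- toℚ y₀)) gap≡0 ⟩
  0ℚ + (toℚ y ℚ.- toℚ y₀)                                        ≡⟨ ℚP.+-identityˡ _ ⟩
  toℚ y ℚ.- toℚ y₀                                               ≡⟨ toℚ-- y y₀ ⟨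
  toℚ (y - y₀)                                                   ∎
  where
  open ≡-Reasoning
  open ℚ-Solver
  gap≡0 = trans (cong (ℚ._- (r * toℚ x + toℚ y)) same) (ℚP.+-inverseʳ (r * toℚ x + toℚ y))

order-unique : ∀ {n} (G : Multigraph n) D {m m′} → IsOrder G D m → IsOrder G D m′ → m ≡ m′
order-unique G D {m} {m′} (1≤m , mD-principal , m-minimal) (1≤m′ , m′D-principal , m′-minimal)
  with ℕP.<-cmp m m′
... | tri< m<m′ _ _ = ⊥-elim (m′-minimal m 1≤m m<m′ mD-principal)
... | tri≈ _ m≡m′ _ = m≡m′
... | tri> _ _ m′<m = ⊥-elim (m-minimal m′ 1≤m′ m′<m m′D-principal)

-- § The pairing ⟨X,Y⟩ = [X]ᵀ L [Y] for a generalized inverse L of Q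

module Pairing {n} (G : Multigraph n) (walks : ∀ i j → Star (Adjacent G) i j)
               (L : Matℚ n) (QLQ≡Q : (laplacianℚ G ⊗ L) ⊗ laplacianℚ G ≡ laplacianℚ G) where

  open Laplacian G

  row-of-I-QL : Fin n → Vecℚ n
  row-of-I-QL i k = toℚ (δ i k) ℚ.- (Q ⊗ L) i k

  -- It is harmonic because (QL)Q = Q and Q is symmetric.
  row-of-I-QL-harmonic : ∀ i l → (Q *ᵥ row-of-I-QL i) l ≡ 0ℚ
  row-of-I-QL-harmonic i l = begin
    ∑[ k < n ] (Q l k * row-of-I-QL i k)                                    ≡⟨ sum-cong-≗ transpose ⟩
    ∑[ k < n ] (toℚ (δ i k) * Q k l ℚ.- (Q ⊗ L) i k * Q k l)                ≡⟨ ∑-distrib-- _ (λ k → (Q ⊗ L) i k * Q k l) ⟩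
    ∑[ k < n ] (toℚ (δ i k) * Q k l) ℚ.- ∑[ k < n ] ((Q ⊗ L) i k * Q k l)  ≡⟨ cong₂ ℚ._-_ (∑-δ i (λ k → Q k l)) QLQ-entry ⟩
    Q i l ℚ.- Q i l                                                         ≡⟨ ℚP.+-inverseʳ (Q i l) ⟩
    0ℚ                                                                      ∎
    where
    open ≡-Reasoning
    open ℚ-Solver
    transpose : ∀ k → Q l k * row-of-I-QL i k ≡ toℚ (δ i k) * Q k l ℚ.- (Q ⊗ L) i k * Q k l
    transpose k = trans (cong (_* row-of-I-QL i k) (Q-symmetric l k))
      (solve 3 (λ q d p → q :* (d :- p) := d :* q :- p :* q) refl (Q k l) (toℚ (δ i k)) ((Q ⊗ L) i k))
    QLQ-entry : ∑[ k < n ] ((Q ⊗ L) i k * Q k l) ≡ Q i l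
    QLQ-entry = trans (sym (sumℚ≡∑ (λ k → (Q ⊗ L) i k * Q k l))) (cong (λ M → M i l) QLQ≡Q)

  -- The generalized inverse inverts Q on vectors summing to zero: Q(LY) = Y.  Indeed
  -- Yᵢ - (QLY)ᵢ = Σₖ wₖ Yₖ for w the i-th row of I - QL, which is harmonic, hence constant.
  QL-identity : ∀ (Y : Vecℚ n) → ∑[ k < n ] Y k ≡ 0ℚ → ∀ i → (Q *ᵥ (L *ᵥ Y)) i ≡ Y i
  QL-identity Y ∑Y≡0 i = sym (x-y≡0⇒x≡y (Y i) ((Q *ᵥ (L *ᵥ Y)) i) (begin
    Y i ℚ.- (Q *ᵥ (L *ᵥ Y)) i                                           ≡⟨ cong₂ ℚ._-_ (sym (∑-δ i Y)) (*ᵥ-⊗ Q L Y i) ⟩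
    ∑[ k < n ] (toℚ (δ i k) * Y k) ℚ.- ∑[ k < n ] ((Q ⊗ L) i k * Y k)   ≡⟨ ∑-distrib-- _ (λ k → (Q ⊗ L) i k * Y k) ⟨
    ∑[ k < n ] (toℚ (δ i k) * Y k ℚ.- (Q ⊗ L) i k * Y k)                ≡⟨ sum-cong-≗ factor ⟩
    ∑[ k < n ] (w k * Y k)                                              ≡⟨ sum-cong-≗ (λ k → cong (_* Y k) (w-constant k)) ⟩
    ∑[ k < n ] (w i * Y k)                                              ≡⟨ *-distribˡ-sum (w i) Y ⟨
    w i * ∑[ k < n ] Y k                                                ≡⟨ cong (w i *_) ∑Y≡0 ⟩
    w i * 0ℚ                                                            ≡⟨ ℚP.*-zeroʳ (w i) ⟩
    0ℚ                                                                  ∎))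
    where
    open ≡-Reasoning
    open ℚ-Solver
    w = row-of-I-QL i
    w-constant : ∀ k → w k ≡ w i
    w-constant k = harmonic⇒constant walks w (row-of-I-QL-harmonic i) k i
    factor : ∀ k → toℚ (δ i k) * Y k ℚ.- (Q ⊗ L) i k * Y k ≡ w k * Y k
    factor k = solve 3 (λ d p y → d :* y :- p :* y := (d :- p) :* y) refl (toℚ (δ i k)) ((Q ⊗ L) i k) (Y k)

  QL-identity-Div⁰ : ∀ Y → InDiv0 Y → ∀ i → (Q *ᵥ (L *ᵥ [ Y ])) i ≡ [ Y ] i
  QL-identity-Div⁰ Y Y∈Div⁰ = QL-identity [ Y ] (Div⁰⇒∑≡0 Y Y∈Div⁰)

  pairing-+ : ∀ F A C Y → (∀ v → F v ≡ A v ℤ.+ C v) → bilin F L Y ≡ bilin A L Y + bilin C L Y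
  pairing-+ F A C Y F≡A+C = begin
    bilin F L Y                                   ≡⟨ bilin-· F L Y ⟩
    [ F ] · u                                     ≡⟨ sum-cong-≗ split ⟩
    ∑[ i < n ] ([ A ] i * u i + [ C ] i * u i)    ≡⟨ ∑-distrib-+ (λ i → [ A ] i * u i) (λ i → [ C ] i * u i) ⟩
    [ A ] · u + [ C ] · u                         ≡⟨ cong₂ _+_ (bilin-· A L Y) (bilin-· C L Y) ⟨
    bilin A L Y + bilin C L Y                     ∎
    where
    open ≡-Reasoning
    u = L *ᵥ [ Y ]
    split : ∀ i → [ F ] i * u i ≡ [ A ] i * u i + [ C ] i * u i
    split i = trans (cong (λ z → toℚ z * u i) (F≡A+C i))
                    (trans (cong (_* u i) (toℚ-+ (A i) (C i))) (ℚP.*-distribʳ-+ (u i) ([ A ] i) ([ C ] i)))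

  pairing-scale : ∀ k A Y → bilin (k ·ᴰ A) L Y ≡ toℚ k * bilin A L Y
  pairing-scale k A Y = begin
    bilin (k ·ᴰ A) L Y                     ≡⟨ bilin-· (k ·ᴰ A) L Y ⟩
    ∑[ i < n ] (toℚ (k ℤ.* A i) * u i)     ≡⟨ sum-cong-≗ (λ i → trans (cong (_* u i) (toℚ-* k (A i)))
                                                                       (ℚP.*-assoc (toℚ k) ([ A ] i) (u i))) ⟩
    ∑[ i < n ] (toℚ k * ([ A ] i * u i))   ≡⟨ *-distribˡ-sum (toℚ k) (λ i → [ A ] i * u i) ⟨
    toℚ k * ([ A ] · u)                    ≡⟨ cong (toℚ k *_) (bilin-· A L Y) ⟨
    toℚ k * bilin A L Y                    ∎
    where
    open ≡-Reasoning
    u = L *ᵥ [ Y ]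

  pairing-cong : ∀ {X X′} Y → (∀ v → X v ≡ X′ v) → bilin X L Y ≡ bilin X′ L Y
  pairing-cong {X} {X′} Y X≗X′ =
    trans (bilin-· X L Y) (trans (·-congˡ (L *ᵥ [ Y ]) (λ v → cong toℚ (X≗X′ v))) (sym (bilin-· X′ L Y)))

  -- Pairing div f with Y ∈ Div⁰ gives the integer Σᵢ fᵢ Yᵢ, as [div f] = Q[f] and QL[Y] = [Y].
  pairing-divf : ∀ f Y → InDiv0 Y → bilin (divf G f) L Y ≡ toℚ (sumℤ (λ i → f i ℤ.* Y i))
  pairing-divf f Y Y∈Div⁰ = begin
    bilin (divf G f) L Y             ≡⟨ bilin-· (divf G f) L Y ⟩
    [ divf G f ] · (L *ᵥ [ Y ])      ≡⟨ ·-congˡ (L *ᵥ [ Y ]) (divf-Q f) ⟩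
    (Q *ᵥ [ f ]) · (L *ᵥ [ Y ])      ≡⟨ *ᵥ-self-adjoint Q-symmetric [ f ] (L *ᵥ [ Y ]) ⟩
    [ f ] · (Q *ᵥ (L *ᵥ [ Y ]))      ≡⟨ ·-congʳ [ f ] (QL-identity-Div⁰ Y Y∈Div⁰) ⟩
    [ f ] · [ Y ]                    ≡⟨ sum-cong-≗ (λ i → toℚ-* (f i) (Y i)) ⟨
    ∑[ i < n ] toℚ (f i ℤ.* Y i)     ≡⟨ toℚ-sumℤ (λ i → f i ℤ.* Y i) ⟨
    toℚ (sumℤ (λ i → f i ℤ.* Y i))   ∎
    where open ≡-Reasoning

  principal-pairing : ∀ X → InPrin G X → ∀ Y → InDiv0 Y → ∃ λ z → bilin X L Y ≡ toℚ z
  principal-pairing X (f , X≗divf) Y Y∈Div⁰ =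
    sumℤ (λ i → f i ℤ.* Y i) , trans (pairing-cong Y X≗divf) (pairing-divf f Y Y∈Div⁰)

  pairing-class : ∀ F A m (F~mA : SameClass G F (m ·ᴰ A)) Y → InDiv0 Y →
                  bilin F L Y ≡ toℚ m * bilin A L Y + toℚ (sumℤ (λ i → proj₁ F~mA i ℤ.* Y i))
  pairing-class F A m (g , F-mA≡divg) Y Y∈Div⁰ =
    trans (pairing-+ F (m ·ᴰ A) (divf G g) Y F≡mA+divg) (cong₂ _+_ (pairing-scale m A Y) (pairing-divf g Y Y∈Div⁰))
    where
    open ℤ-Solver
    F≡mA+divg : ∀ v → F v ≡ m ℤ.* A v ℤ.+ divf G g v
    F≡mA+divg v = trans (solve 2 (λ p q → p := q :+ (p :- q)) refl (F v) (m ℤ.* A v))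
                        (cong (λ c → m ℤ.* A v ℤ.+ c) (F-mA≡divg v))

  -- On Div⁰ the pairing is symmetric: ⟨X,Y⟩ = ⟨QL X, L Y⟩ = ⟨L X, QL Y⟩ = ⟨Y,X⟩.
  pairing-symmetric : ∀ X Y → InDiv0 X → InDiv0 Y → bilin X L Y ≡ bilin Y L X
  pairing-symmetric X Y X∈Div⁰ Y∈Div⁰ = begin
    bilin X L Y                            ≡⟨ bilin-· X L Y ⟩
    [ X ] · (L *ᵥ [ Y ])                   ≡⟨ ·-congˡ (L *ᵥ [ Y ]) (QL-identity-Div⁰ X X∈Div⁰) ⟨
    (Q *ᵥ (L *ᵥ [ X ])) · (L *ᵥ [ Y ])     ≡⟨ *ᵥ-self-adjoint Q-symmetric (L *ᵥ [ X ]) (L *ᵥ [ Y ]) ⟩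
    (L *ᵥ [ X ]) · (Q *ᵥ (L *ᵥ [ Y ]))     ≡⟨ ·-congʳ (L *ᵥ [ X ]) (QL-identity-Div⁰ Y Y∈Div⁰) ⟩
    (L *ᵥ [ X ]) · [ Y ]                   ≡⟨ ·-comm (L *ᵥ [ X ]) [ Y ] ⟩
    [ Y ] · (L *ᵥ [ X ])                   ≡⟨ bilin-· Y L X ⟨
    bilin Y L X                            ∎
    where open ≡-Reasoning

  pairing-v-diff : ∀ i j X → bilin (v-diff i j) L X ≡ (L *ᵥ [ X ]) i ℚ.- (L *ᵥ [ X ]) j
  pairing-v-diff i j X = trans (bilin-· (v-diff i j) L X) (∑-v-diff i j (L *ᵥ [ X ]))

  -- X ∈ Div⁰ is principal once it pairs integrally with all of Div⁰: for h = L[X] and a base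
  -- vertex i₀ the values fᵢ = hᵢ - h_{i₀} = ⟨(vᵢ) - (v_{i₀}), X⟩ are integers, and
  -- Q[f] = Qh = [X] because Q only sees differences.
  principal-criterion : Fin n → ∀ X → InDiv0 X →
                        (∀ F → InDiv0 F → ∃ λ z → bilin F L X ≡ toℚ z) → InPrin G X
  principal-criterion i₀ X X∈Div⁰ integral = f , λ v → toℚ-injective (begin
    [ X ] v                                      ≡⟨ QL-identity-Div⁰ X X∈Div⁰ v ⟨
    (Q *ᵥ h) v                                   ≡⟨ Q-action h v ⟩
    ∑[ j < n ] (μ v j * (h v ℚ.- h j))           ≡⟨ sum-cong-≗ (λ j → cong (μ v j *_) (same-differences v j)) ⟩
    ∑[ j < n ] (μ v j * ([ f ] v ℚ.- [ f ] j))   ≡⟨ Q-action [ f ] v ⟨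
    (Q *ᵥ [ f ]) v                               ≡⟨ divf-Q f v ⟨
    [ divf G f ] v                               ∎)
    where
    open ≡-Reasoning
    open ℚ-Solver
    h = L *ᵥ [ X ]
    f : Fin n → ℤ
    f i = proj₁ (integral (v-diff i i₀) (Div⁰-v-diff i i₀))
    [f]≡ : ∀ i → [ f ] i ≡ h i ℚ.- h i₀
    [f]≡ i = trans (sym (proj₂ (integral (v-diff i i₀) (Div⁰-v-diff i i₀)))) (pairing-v-diff i i₀ X)
    same-differences : ∀ i j → h i ℚ.- h j ≡ [ f ] i ℚ.- [ f ] j
    same-differences i j =
      trans (solve 3 (λ a b c → a :- b := (a :- c) :- (b :- c)) refl (h i) (h j) (h i₀))
            (sym (cong₂ ℚ._-_ ([f]≡ i) ([f]≡ j)))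

  -- When Ē generates Jac(G), pairing integrally with E alone makes X ∈ Div⁰ principal,
  -- since every F ∈ Div⁰ is m·E + div g.
  generator-criterion : Fin n → ∀ E → CyclicGenerator G E → ∀ X → InDiv0 X →
                        ∀ z → bilin E L X ≡ toℚ z → InPrin G X
  generator-criterion i₀ E (_ , cyclic) X X∈Div⁰ z ⟨E,X⟩≡z = principal-criterion i₀ X X∈Div⁰ integral
    where
    integral : ∀ F → InDiv0 F → ∃ λ w → bilin F L X ≡ toℚ w
    integral F F∈Div⁰ with cyclic F F∈Div⁰
    ... | m , F~mE = m ℤ.* z ℤ.+ c , (begin
      bilin F L X                   ≡⟨ pairing-class F E m F~mE X X∈Div⁰ ⟩
      toℚ m * bilin E L X + toℚ c   ≡⟨ cong (λ e → toℚ m * e + toℚ c) ⟨E,X⟩≡z ⟩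
      toℚ m * toℚ z + toℚ c         ≡⟨ cong (_+ toℚ c) (toℚ-* m z) ⟨
      toℚ (m ℤ.* z) + toℚ c         ≡⟨ toℚ-+ (m ℤ.* z) c ⟨
      toℚ (m ℤ.* z ℤ.+ c)           ∎)
      where
      open ≡-Reasoning
      c = sumℤ (λ i → proj₁ F~mE i ℤ.* X i)

  -- If Ē generates Jac(G) and ⟨D,E⟩ = a/b in lowest terms, then b is the order of D̄:
  -- k·D principal makes k·(a/b) = ⟨k·D,E⟩ an integer, so b ∣ k; and ⟨E,b·D⟩ = b·(a/b) = a.
  order-is-denominator : Fin n → ∀ E → CyclicGenerator G E → ∀ D → InDiv0 D →
                         ∀ a b .{{_ : NonZero b}} → Coprime ∣ a ∣ b → bilin D L E ≡ a / b →
                         IsOrder G D b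
  order-is-denominator i₀ E generator D D∈Div⁰ a b a⊥b ⟨D,E⟩≡a/b =
    ℕ.>-nonZero⁻¹ b , bD-principal , kD-not-principal
    where
    open ≡-Reasoning
    E∈Div⁰ = proj₁ generator
    bD∈Div⁰ = Div⁰-scale (+ b) D D∈Div⁰

    bD-principal : InPrin G ((+ b) ·ᴰ D)
    bD-principal = generator-criterion i₀ E generator ((+ b) ·ᴰ D) bD∈Div⁰ a (begin
      bilin E L ((+ b) ·ᴰ D)      ≡⟨ pairing-symmetric E ((+ b) ·ᴰ D) E∈Div⁰ bD∈Div⁰ ⟩
      bilin ((+ b) ·ᴰ D) L E      ≡⟨ pairing-scale (+ b) D E ⟩
      toℚ (+ b) * bilin D L E     ≡⟨ cong (toℚ (+ b) *_) ⟨D,E⟩≡a/b ⟩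
      toℚ (+ b) * (a / b)         ≡⟨ *-/-cancel a b ⟩
      toℚ a                       ∎)

    kD-not-principal : ∀ k → 1 ℕ.≤ k → k ℕ.< b → ¬ InPrin G ((+ k) ·ᴰ D)
    kD-not-principal k 1≤k k<b kD-principal = ℕP.<⇒≱ k<b (ℕD.∣⇒≤ {{ℕ.>-nonZero 1≤k}} b∣k)
      where
      integral = principal-pairing ((+ k) ·ᴰ D) kD-principal E E∈Div⁰
      b∣k : b ℕD.∣ k
      b∣k = denominator-divides a b a⊥b (+ k) (proj₁ integral) (begin
        toℚ (+ k) * (a / b)         ≡⟨ cong (toℚ (+ k) *_) ⟨D,E⟩≡a/b ⟨
        toℚ (+ k) * bilin D L E     ≡⟨ pairing-scale (+ k) D E ⟨
        bilin ((+ k) ·ᴰ D) L E      ≡⟨ proj₂ integral ⟩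
        toℚ (proj₁ integral)        ∎)

mainTheorem3 : ∀ {n} (G : Multigraph n) → Connected G →
    (E : Div n) → CyclicGenerator G E →
    (L : Matℚ n) → (laplacianℚ G ⊗ L) ⊗ laplacianℚ G ≡ laplacianℚ G →
    (D D' : Div n) → InDiv0 D → InDiv0 D' →
    (x : ℤ) → SameClass G D' (x ·ᴰ D) →
    (a : ℤ) (b : ℕ) .{{_ : NonZero b}} → Coprime ∣ a ∣ b →
    bilin D L E ≡ a / b →
    IsOrder G D b
    × (∃₂ λ (x₀ y₀ : ℤ) → bilin D' L E ≡ bilin D L E * toℚ x₀ + toℚ y₀)
    × (∀ (m : ℕ) → IsOrder G D m → ∀ (x₀ y₀ : ℤ) →
         bilin D' L E ≡ bilin D L E * toℚ x₀ + toℚ y₀ → + m ∣ (x₀ - x))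
mainTheorem3 G (1≤n , walks) E generator L QLQ≡Q D D' D∈Div⁰ _ x D'~xD a b a⊥b r≡a/b =
  order , (x , y , r'≡rx+y) , logarithm-mod-order
  where
  open Pairing G walks L QLQ≡Q
  r = bilin D L E
  y = sumℤ (λ i → proj₁ D'~xD i ℤ.* E i)

  order : IsOrder G D b
  order = order-is-denominator (fromℕ< 1≤n) E generator D D∈Div⁰ a b a⊥b r≡a/b

  -- D' = x·D + div g gives r' = r·x + Σ g·E.
  r'≡rx+y : bilin D' L E ≡ r * toℚ x + toℚ y
  r'≡rx+y = trans (pairing-class D' D x D'~xD E (proj₁ generator)) (cong (_+ toℚ y) (ℚP.*-comm (toℚ x) r))

  -- Any solution has (x₀ - x)·r ∈ ℤ, so the denominator b = ord(D̄) divides x₀ - x.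
  logarithm-mod-order : ∀ m → IsOrder G D m → ∀ x₀ y₀ → bilin D' L E ≡ r * toℚ x₀ + toℚ y₀ → + m ∣ (x₀ - x)
  logarithm-mod-order m m-order x₀ y₀ r'≡rx₀+y₀ =
    subst (λ k → k ℕD.∣ ∣ x₀ - x ∣) (order-unique G D order m-order)
      (denominator-divides a b a⊥b (x₀ - x) (y - y₀)
        (trans (cong (toℚ (x₀ - x) *_) (sym r≡a/b)) (solutions-differ r x₀ y₀ x y (trans (sym r'≡rx₀+y₀) r'≡rx+y))))
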